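{- Let $v=v_1\cdots v_n$ be a word of $n$ distinct positive integers avoiding the patterns $3142$ and $3241$. Group the positions of the left-to-right maxima of $v$ into maximal runs of consecutive positions: the left-to-right maxima of $v$ occur exactly at positions $j_s,j_s+1,\dots,j_s+l_s$ for $s=1,\dots,k+1$, where $j_1=1$ and $j_s+l_s+1<j_{s+1}$ for $1\le s\le k$. Write $$v=v_{j_1}\cdots v_{j_1+l_1}\,d_1\,v_{j_2}\cdots v_{j_2+l_2}\,d_2\cdots v_{j_{k+1}}\cdots v_{j_{k+1}+l_{k+1}}\,d_{k+1},$$ where $d_1,\dots,d_{k+1}$ are the factors of consecutive entries between these runs ($d_{k+1}$ possibly empty). Then all entries of $d_1$ are smaller than $v_{j_1+l_1}$, and for $2\le s\le k+1$ all entries of $d_s$ are smaller than $v_{j_s+l_s}$ and larger than $v_{j_{s-1}+l_{s-1}}$.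
   Context: A word contains a pattern $P$ if it has a subsequence order-isomorphic to $P$, and avoids $P$ otherwise. A left-to-right maximum of $v$ is an entry $v_i$ with $v_i>v_j$ for all $j<i$. -}

module Defs where

open import Data.Nat as ℕ using (ℕ; suc)
open import Data.List using (List; []; _∷_; length; lookup)
open import Data.List.Relation.Unary.All using (All)
open import Data.Fin as Fin using (Fin; toℕ)
open import Data.Product using (∃)
open import Function.Bundles using (_⇔_)
open import Relation.Nullary using (¬_)
open import Relation.Binary.PropositionalEquality using (_≡_)

-- A word is a finite list of natural numbers; positions are Fin (length w)
-- (0-based internally).
Word : Set
Word = List ℕ

Positive : Word → Set
Positive w = All (ℕ._<_ 0) w

DistinctEntries : Word → Set
DistinctEntries w = ∀ (i j : Fin (length w)) → lookup w i ≡ lookup w j → i ≡ j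

Contains : Word → Word → Set
Contains P w =
  ∃ λ (f : Fin (length P) → Fin (length w)) →
    (∀ a b → a Fin.< b → f a Fin.< f b) ×'
    (∀ a b → (lookup P a ℕ.< lookup P b) ⇔ (lookup w (f a) ℕ.< lookup w (f b)))
  where open import Data.Product renaming (_×_ to _×'_)

Avoids : Word → Word → Set
Avoids P w = ¬ Contains P w

p3142 : Word
p3142 = 3 ∷ 1 ∷ 4 ∷ 2 ∷ []

p3241 : Word
p3241 = 3 ∷ 2 ∷ 4 ∷ 1 ∷ []

IsLRmax : (w : Word) → Fin (length w) → Set
IsLRmax w i = ∀ j → j Fin.< i → lookup w j ℕ.< lookup w i

{-# OPTIONS --safe #-}
-- An entry lying after the last maximum m of a run of left-to-right maxima,
-- but before the next run, is at most v_m: an entry exceeding v_m would exceed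
-- everything before it and so be a left-to-right maximum itself.  For the lower
-- bound let p be the last maximum of the previous run and q = p + 1, so
-- v_q < v_p < v_m.  If some later entry v_i were below v_p, then p q m i would
-- form 3142 when v_q < v_i and 3241 when v_i < v_q.
module Submission where

open import Defs
open import Data.Nat as ℕ using (ℕ; suc)
import Data.Nat.Properties as ℕₚ
open import Data.List using (length; lookup)
open import Data.Fin as Fin using (Fin; toℕ; #_)
import Data.Fin.Properties as Finₚ
open import Data.Fin.Induction using (<-wellFounded)
open import Data.Vec.Functional using ([]; _∷_)
open import Data.Product using (_×_; _,_)
open import Data.Sum using (_⊎_; inj₁; inj₂; [_,_]′)
open import Data.Empty using (⊥-elim)
open import Function.Base using (_∘_)
open import Function.Bundles using (_⇔_; mk⇔)
open import Induction.WellFounded using (Acc; acc)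
open import Relation.Nullary using (¬_)
open import Relation.Nullary.Decidable using (from-yes)
open import Relation.Binary.Definitions using (tri<; tri≈; tri>)
open import Relation.Binary.PropositionalEquality using (_≡_; _≢_; refl; sym; subst; subst₂)

StrictlyIncreasing : ∀ {n} → (Fin n → ℕ) → Set
StrictlyIncreasing f = ∀ a b → a Fin.< b → f a ℕ.< f b

strictlyIncreasing-stepwise : ∀ {n} (f : Fin (suc n) → ℕ) →
  (∀ a → f (Fin.inject₁ a) ℕ.< f (Fin.suc a)) → StrictlyIncreasing f
strictlyIncreasing-stepwise f step Fin.zero (Fin.suc Fin.zero) _ = step Fin.zero
strictlyIncreasing-stepwise {suc _} f step Fin.zero (Fin.suc b@(Fin.suc _)) _ =
  ℕₚ.<-trans (step Fin.zero)
    (strictlyIncreasing-stepwise (f ∘ Fin.suc) (step ∘ Fin.suc) Fin.zero b ℕ.z<s)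
strictlyIncreasing-stepwise {suc _} f step (Fin.suc a) (Fin.suc b) a<b =
  strictlyIncreasing-stepwise (f ∘ Fin.suc) (step ∘ Fin.suc) a b (ℕ.s<s⁻¹ a<b)

strictlyIncreasing₄ : (f : Fin 4 → ℕ) →
  f (# 0) ℕ.< f (# 1) → f (# 1) ℕ.< f (# 2) → f (# 2) ℕ.< f (# 3) →
  StrictlyIncreasing f
strictlyIncreasing₄ f f₀<f₁ f₁<f₂ f₂<f₃ = strictlyIncreasing-stepwise f λ where
  Fin.zero → f₀<f₁
  (Fin.suc Fin.zero) → f₁<f₂
  (Fin.suc (Fin.suc Fin.zero)) → f₂<f₃

strictlyIncreasing-reflects-< : ∀ {n} (f : Fin n → ℕ) → StrictlyIncreasing f →
  ∀ {a b} → f a ℕ.< f b → a Fin.< b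
strictlyIncreasing-reflects-< f f↑ {a} {b} fa<fb with Finₚ.<-cmp a b
... | tri< a<b _ _ = a<b
... | tri≈ _ refl _ = ⊥-elim (ℕₚ.<-irrefl refl fa<fb)
... | tri> _ _ b<a = ⊥-elim (ℕₚ.<-asym fa<fb (f↑ b a b<a))

-- Two sequences that both increase along the enumeration σ are ordered alike,
-- since both orders coincide with the order of the σ-indices.
sameOrder-increasingAlong : ∀ {n} (σ ρ : Fin n → Fin n) → (∀ a → σ (ρ a) ≡ a) →
  (u v : Fin n → ℕ) → StrictlyIncreasing (u ∘ σ) → StrictlyIncreasing (v ∘ σ) →
  ∀ a b → (u a ℕ.< u b) ⇔ (v a ℕ.< v b)
sameOrder-increasingAlong σ ρ σ∘ρ≗id u v uσ↑ vσ↑ a b =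
  subst₂ (λ x y → (u x ℕ.< u y) ⇔ (v x ℕ.< v y)) (σ∘ρ≗id a) (σ∘ρ≗id b)
    (mk⇔ (vσ↑ _ _ ∘ strictlyIncreasing-reflects-< (u ∘ σ) uσ↑)
         (uσ↑ _ _ ∘ strictlyIncreasing-reflects-< (v ∘ σ) vσ↑))

contains-increasingAlong : (P w : Word) (σ ρ : Fin (length P) → Fin (length P)) →
  (∀ a → σ (ρ a) ≡ a) → StrictlyIncreasing (lookup P ∘ σ) →
  (f : Fin (length P) → Fin (length w)) → StrictlyIncreasing (toℕ ∘ f) →
  StrictlyIncreasing (lookup w ∘ f ∘ σ) → Contains P w
contains-increasingAlong P w σ ρ σ∘ρ≗id Pσ↑ f f↑ wfσ↑ =
  f , f↑ , sameOrder-increasingAlong σ ρ σ∘ρ≗id (lookup P) (lookup w ∘ f) Pσ↑ wfσ↑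

module _ (w : Word) {a b c d : Fin (length w)}
         (a<b : a Fin.< b) (b<c : b Fin.< c) (c<d : c Fin.< d) where

  private
    positions : Fin 4 → Fin (length w)
    positions = a ∷ b ∷ c ∷ d ∷ []

    positions↑ : StrictlyIncreasing (toℕ ∘ positions)
    positions↑ = strictlyIncreasing₄ _ a<b b<c c<d

  -- Below, σ lists the pattern's positions in increasing order of value and
  -- ρ is its inverse.
  contains-3142 : lookup w b ℕ.< lookup w d → lookup w d ℕ.< lookup w a →
    lookup w a ℕ.< lookup w c → Contains p3142 w
  contains-3142 wb<wd wd<wa wa<wc =
    contains-increasingAlong p3142 w σ ρ σ∘ρ≗id
      (strictlyIncreasing₄ _ (ℕₚ.n<1+n 1) (ℕₚ.n<1+n 2) (ℕₚ.n<1+n 3))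
      positions positions↑ (strictlyIncreasing₄ _ wb<wd wd<wa wa<wc)
    where
    σ ρ : Fin 4 → Fin 4
    σ = # 1 ∷ # 3 ∷ # 0 ∷ # 2 ∷ []
    ρ = # 2 ∷ # 0 ∷ # 3 ∷ # 1 ∷ []
    σ∘ρ≗id : ∀ r → σ (ρ r) ≡ r
    σ∘ρ≗id = from-yes (Finₚ.all? λ r → σ (ρ r) Finₚ.≟ r)

  contains-3241 : lookup w d ℕ.< lookup w b → lookup w b ℕ.< lookup w a →
    lookup w a ℕ.< lookup w c → Contains p3241 w
  contains-3241 wd<wb wb<wa wa<wc =
    contains-increasingAlong p3241 w σ ρ σ∘ρ≗id
      (strictlyIncreasing₄ _ (ℕₚ.n<1+n 1) (ℕₚ.n<1+n 2) (ℕₚ.n<1+n 3))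
      positions positions↑ (strictlyIncreasing₄ _ wd<wb wb<wa wa<wc)
    where
    σ ρ : Fin 4 → Fin 4
    σ = # 3 ∷ # 1 ∷ # 0 ∷ # 2 ∷ []
    ρ = # 2 ∷ # 1 ∷ # 3 ∷ # 0 ∷ []
    σ∘ρ≗id : ∀ r → σ (ρ r) ≡ r
    σ∘ρ≗id = from-yes (Finₚ.all? λ r → σ (ρ r) Finₚ.≟ r)

lookup-≢-< : ∀ (w : Word) → DistinctEntries w →
  ∀ {x y} → x Fin.< y → lookup w x ≢ lookup w y
lookup-≢-< w distinct {x} {y} x<y wx≡wy = Finₚ.<-irrefl (distinct x y wx≡wy) x<y

contains-3142⊎3241 : ∀ (w : Word) → DistinctEntries w → {p q m i : Fin (length w)} →
  p Fin.< q → q Fin.< m → m Fin.< i →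
  lookup w q ℕ.< lookup w p → lookup w p ℕ.< lookup w m → lookup w i ℕ.< lookup w p →
  Contains p3142 w ⊎ Contains p3241 w
contains-3142⊎3241 w distinct {q = q} {i = i} p<q q<m m<i wq<wp wp<wm wi<wp
  with ℕₚ.<-cmp (lookup w q) (lookup w i)
... | tri< wq<wi _ _ = inj₁ (contains-3142 w p<q q<m m<i wq<wi wi<wp wp<wm)
... | tri≈ _ wq≡wi _ = ⊥-elim (lookup-≢-< w distinct (ℕₚ.<-trans q<m m<i) wq≡wi)
... | tri> _ _ wi<wq = inj₂ (contains-3241 w p<q q<m m<i wi<wq wq<wp wp<wm)

lookup-≤-precedingLRmax : ∀ (w : Word) {m i : Fin (length w)} → IsLRmax w m →
  (∀ k → m Fin.< k → k Fin.≤ i → ¬ IsLRmax w k) →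
  ∀ k → k Fin.≤ i → lookup w k ℕ.≤ lookup w m
lookup-≤-precedingLRmax w {m} {i} m-max no-max k = go (<-wellFounded k)
  where
  go : ∀ {k} → Acc Fin._<_ k → k Fin.≤ i → lookup w k ℕ.≤ lookup w m
  go {k} (acc smaller) k≤i with Finₚ.<-cmp k m
  ... | tri< k<m _ _ = ℕₚ.<⇒≤ (m-max k k<m)
  ... | tri≈ _ refl _ = ℕₚ.≤-refl
  ... | tri> _ _ m<k = ℕₚ.≮⇒≥ λ wm<wk → no-max k m<k k≤i λ j j<k →
    ℕₚ.≤-<-trans (go (smaller j<k) (ℕₚ.<⇒≤ (ℕₚ.<-≤-trans j<k k≤i))) wm<wk

lookup-<-precedingLRmax : ∀ (w : Word) → DistinctEntries w → {m i : Fin (length w)} →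
  IsLRmax w m → (∀ k → m Fin.< k → k Fin.≤ i → ¬ IsLRmax w k) →
  m Fin.< i → lookup w i ℕ.< lookup w m
lookup-<-precedingLRmax w distinct m-max no-max m<i =
  ℕₚ.≤∧≢⇒< (lookup-≤-precedingLRmax w m-max no-max _ ℕₚ.≤-refl)
            (λ wi≡wm → lookup-≢-< w distinct m<i (sym wi≡wm))

lookup-<-pastLaterLRmax : ∀ (w : Word) → DistinctEntries w →
  Avoids p3142 w → Avoids p3241 w → {p t m i : Fin (length w)} →
  IsLRmax w p → IsLRmax w m → suc (toℕ p) ℕ.< toℕ t → t Fin.≤ m → m Fin.< i →
  (∀ k → p Fin.< k → k Fin.< t → ¬ IsLRmax w k) →
  lookup w p ℕ.< lookup w i
lookup-<-pastLaterLRmax w distinct avoids3142 avoids3241 {p} {t} {m} {i}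
  p-max m-max p+1<t t≤m m<i no-max-pt = ℕₚ.≰⇒> λ wi≤wp →
    [ avoids3142 , avoids3241 ]′ (contains-3142⊎3241 w distinct p<q q<m m<i
      wq<wp (m-max p p<m) (ℕₚ.≤∧≢⇒< wi≤wp (lookup-≢-< w distinct p<i ∘ sym)))
  where
  q : Fin (length w)
  q = Fin.fromℕ< (ℕₚ.<-trans p+1<t (Finₚ.toℕ<n t))
  p<q : p Fin.< q
  p<q = subst (toℕ p ℕ.<_) (sym (Finₚ.toℕ-fromℕ< _)) (ℕₚ.n<1+n (toℕ p))
  q<t : q Fin.< t
  q<t = subst (ℕ._< toℕ t) (sym (Finₚ.toℕ-fromℕ< _)) p+1<t
  q<m : q Fin.< m
  q<m = ℕₚ.<-≤-trans q<t t≤m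
  p<m : p Fin.< m
  p<m = Finₚ.<-trans p<q q<m
  p<i : p Fin.< i
  p<i = Finₚ.<-trans p<m m<i
  wq<wp : lookup w q ℕ.< lookup w p
  wq<wp = lookup-<-precedingLRmax w distinct p-max
    (λ k p<k k≤q → no-max-pt k p<k (ℕₚ.≤-<-trans k≤q q<t)) p<q

proposition2p3 :
    (w : Word) → Positive w → DistinctEntries w →
    Avoids p3142 w → Avoids p3241 w →
    -- m is the last position of a run of LR-maxima, i lies in the factor d
    -- following that run (all positions in (m, i] are not LR-maxima)
    (m i : Fin (length w)) → m Fin.< i → IsLRmax w m →
    (∀ k → m Fin.< k → k Fin.≤ i → ¬ IsLRmax w k) →
    (lookup w i ℕ.< lookup w m)
    ×
    -- p is the last position of the previous run: positions in (p, t) form a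
    -- nonempty factor of non-LR-maxima and [t, m] is the run ending at m
    (∀ (p t : Fin (length w)) → IsLRmax w p → suc (toℕ p) ℕ.< toℕ t → t Fin.≤ m →
      (∀ k → p Fin.< k → k Fin.< t → ¬ IsLRmax w k) →
      (∀ k → t Fin.≤ k → k Fin.≤ m → IsLRmax w k) →
      lookup w p ℕ.< lookup w i)
proposition2p3 w _ distinct avoids3142 avoids3241 m i m<i m-max no-max =
  lookup-<-precedingLRmax w distinct m-max no-max m<i ,
  λ p t p-max p+1<t t≤m no-max-pt _ →
    lookup-<-pastLaterLRmax w distinct avoids3142 avoids3241
      p-max m-max p+1<t t≤m m<i no-max-pt
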